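{- Let $R_n(x)=\sum_{k=0}^{n-1} c_n(k)x^k$. Then $R_2(-1)=2$, and (i) $R_n(-1)=\varphi(n)$ for every odd $n\ge 1$; (ii) $R_n(-1)=0$ for every even $n>2$; (iii) for every $n\ge 1$, the $n$th cyclotomic polynomial $\Phi_n(x)$ divides the polynomial $R_n(x)-n$.
   Context: For integers $n\ge 1$ and $k$, the Ramanujan sum is $c_n(k)=\sum_{1\le j\le n,\ \gcd(j,n)=1} e^{2\pi i jk/n}$. $\varphi$ is Euler's totient function and $\Phi_n(x)=\prod_{1\le j\le n,\ \gcd(j,n)=1}(x-e^{2\pi i j/n})$ is the $n$th cyclotomic polynomial. -}

module Defs where

open import Level using (_⊔_)
open import Data.Nat as ℕ using (ℕ; zero; suc)
open import Data.Nat.Coprimality using (Coprime; coprime?)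
open import Data.List using (List; []; _∷_)
open import Data.Product using (Σ; ∃)
open import Data.Sum using (_⊎_)
open import Relation.Nullary using (¬_; yes; no)
open import Algebra.Bundles using (CommutativeRing)

Even : ℕ → Set
Even n = ∃ λ k → n ≡ℕ 2 ℕ.* k
  where open import Relation.Binary.PropositionalEquality renaming (_≡_ to _≡ℕ_)

Odd : ℕ → Set
Odd n = ∃ λ k → n ≡ℕ suc (2 ℕ.* k)
  where open import Relation.Binary.PropositionalEquality renaming (_≡_ to _≡ℕ_)

totient : ℕ → ℕ
totient n = go n
  where
  go : ℕ → ℕ
  go zero = zero
  go (suc m) with coprime? (suc m) n
  ... | yes _ = suc (go m)
  ... | no  _ = go m

module Ring {c ℓ} (R : CommutativeRing c ℓ) where
  open CommutativeRing R

  pow : Carrier → ℕ → Carrier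
  pow x zero    = 1#
  pow x (suc m) = x * pow x m

  ι : ℕ → Carrier
  ι zero    = 0#
  ι (suc m) = 1# + ι m

  IsDomain : Set (c ⊔ ℓ)
  IsDomain = (¬ (1# ≈ 0#)) Data.Product.× (∀ a b → a * b ≈ 0# → a ≈ 0# ⊎ b ≈ 0#)

  IsPrimitiveRoot : ℕ → Carrier → Set ℓ
  IsPrimitiveRoot n ζ =
    (pow ζ n ≈ 1#) Data.Product.× (∀ m → 0 ℕ.< m → m ℕ.< n → ¬ (pow ζ m ≈ 1#))

  ramanujan : (n : ℕ) → (ζ : Carrier) → (k : ℕ) → Carrier
  ramanujan n ζ k = go n
    where
    go : ℕ → Carrier
    go zero = 0#
    go (suc m) with coprime? (suc m) n
    ... | yes _ = go m + pow ζ (suc m ℕ.* k)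
    ... | no  _ = go m

  -- Polynomials over R: coefficient lists, lowest degree first.
  Poly : Set c
  Poly = List Carrier

  coeff : Poly → ℕ → Carrier
  coeff []       _       = 0#
  coeff (a ∷ p)  zero    = a
  coeff (a ∷ p)  (suc i) = coeff p i

  _≈ₚ_ : Poly → Poly → Set ℓ
  p ≈ₚ q = ∀ i → coeff p i ≈ coeff q i

  _+ₚ_ : Poly → Poly → Poly
  []      +ₚ q       = q
  (a ∷ p) +ₚ []      = a ∷ p
  (a ∷ p) +ₚ (b ∷ q) = (a + b) ∷ (p +ₚ q)

  scale : Carrier → Poly → Poly
  scale a []      = []
  scale a (b ∷ p) = (a * b) ∷ scale a p

  _*ₚ_ : Poly → Poly → Poly
  []      *ₚ q = []
  (a ∷ p) *ₚ q = scale a q +ₚ (0# ∷ (p *ₚ q))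

  -ₚ_ : Poly → Poly
  -ₚ p = scale (- 1#) p

  constₚ : Carrier → Poly
  constₚ a = a ∷ []

  _∣ₚ_ : Poly → Poly → Set (c ⊔ ℓ)
  p ∣ₚ q = Σ Poly λ r → (p *ₚ r) ≈ₚ q

  eval : Poly → Carrier → Carrier
  eval []      x = 0#
  eval (a ∷ p) x = a + x * eval p x

  RPoly : ℕ → Carrier → Poly
  RPoly n ζ = go 0 n
    where
    go : ℕ → ℕ → Poly
    go k zero    = []
    go k (suc m) = ramanujan n ζ k ∷ go (suc k) m

  cyclotomic : ℕ → Carrier → Poly
  cyclotomic n ζ = go n
    where
    go : ℕ → Poly
    go zero = constₚ 1#
    go (suc m) with coprime? (suc m) n
    ... | yes _ = go m *ₚ ((- pow ζ (suc m)) ∷ 1# ∷ [])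
    ... | no  _ = go m

-- Exchanging the two summations turns R_n(x) into a sum of geometric series,
-- R_n(x) = Σ_{j coprime to n} Σ_{k<n} (ζ^j x)^k.  In a domain a geometric series of length n
-- whose ratio r satisfies r^n = 1 vanishes unless r = 1, where it equals n.  At x = -1 with n
-- even and n > 2 no ratio -ζ^j equals 1, so R_n(-1) = 0.  At x = ζ^b with b coprime to n exactly
-- one ratio ζ^(j+b) equals 1, so R_n(ζ^b) = n; since the ζ^b are distinct, R_n - n is divisible
-- by Φ_n.  For odd n the ratio r = -ζ^j has r^n = -1, so (1 + ζ^j) G_j = 2 for the series G_j,
-- and pairing j with n - j gives G_j + G_(n-j) = 2, hence R_n(-1) = φ(n).

module Submission where

open import Defs
open import Data.Nat as ℕ using (ℕ)
open import Data.Product using (_×_)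
open import Relation.Binary.PropositionalEquality using (_≡_)
open import Algebra.Bundles using (CommutativeRing)

open import Data.Nat using (zero; suc; _<_; _≤_; z≤n; s≤s; z<s)
open import Data.Nat.Coprimality using (Coprime; coprime?)
open import Data.List using ([]; _∷_)
open import Data.Nat.Divisibility using (_∣_; ∣m+n∣m⇒∣n)
open import Data.Product using (_,_)
open import Relation.Nullary using (¬_; Dec; yes; no)
import Relation.Binary.PropositionalEquality as ≡
import Data.Nat.Properties as ℕₚ

coprime-complement : ∀ {j j′ n} → j ℕ.+ j′ ≡ n → Coprime j n → Coprime j′ n
coprime-complement {j} {j′} j+j′≡n coprime-j (d∣j′ , d∣n) =
  coprime-j (∣m+n∣m⇒∣n (≡.subst (_ ∣_) (≡.trans (≡.sym j+j′≡n) (ℕₚ.+-comm j j′)) d∣n) d∣j′ , d∣n)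

mirror-sum : ∀ {i h} → i < h → suc i ℕ.+ suc (h ℕ.+ (h ℕ.∸ suc i)) ≡ suc (h ℕ.+ h)
mirror-sum {i} {h} i<h = begin
  suc i ℕ.+ suc (h ℕ.+ d)      ≡⟨ ℕₚ.+-suc (suc i) (h ℕ.+ d) ⟩
  suc (suc i ℕ.+ (h ℕ.+ d))    ≡⟨ ≡.cong suc (≡.sym (ℕₚ.+-assoc (suc i) h d)) ⟩
  suc (suc i ℕ.+ h ℕ.+ d)      ≡⟨ ≡.cong (λ x → suc (x ℕ.+ d)) (ℕₚ.+-comm (suc i) h) ⟩
  suc (h ℕ.+ suc i ℕ.+ d)      ≡⟨ ≡.cong suc (ℕₚ.+-assoc h (suc i) d) ⟩
  suc (h ℕ.+ (suc i ℕ.+ d))    ≡⟨ ≡.cong (λ x → suc (h ℕ.+ x)) (ℕₚ.m+[n∸m]≡n i<h) ⟩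
  suc (h ℕ.+ h)                ∎
  where
  open ≡.≡-Reasoning
  d : ℕ
  d = h ℕ.∸ suc i

-- Defs computes totient, ramanujan, RPoly and cyclotomic by recursions local to a `where` block,
-- which cannot be named.  Each is captured as the solution of a metavariable: after abstracting
-- over `suc m`, the unfolded definition shows the local function applied to variables only, so
-- unification instantiates the metavariable with it.  Afterwards e.g. `ramanujan n ζ k` is
-- definitionally `ramanujanUpTo n ζ k n`.
module Unfolding {c ℓ} (R : CommutativeRing c ℓ) where
  open CommutativeRing R using (Carrier; _+_)
  open Ring R

  mutual
    totientUpTo : ℕ → ℕ → ℕ
    totientUpTo = _

    ramanujanUpTo : ℕ → Carrier → ℕ → ℕ → Carrier
    ramanujanUpTo = _

    RPolyFrom : ℕ → Carrier → ℕ → ℕ → Poly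
    RPolyFrom = _

    cyclotomicUpTo : ℕ → Carrier → ℕ → Poly
    cyclotomicUpTo = _

    totient-capture : ∀ m → totient (suc m) ≡ totient (suc m)
    totient-capture m with coprime? (suc m) (suc m)
    ... | yes _ with suc m
    ...   | N = ≡.cong suc (≡.refl {x = totientUpTo N m})
    totient-capture m | no _ with suc m
    ...   | N = ≡.refl {x = totientUpTo N m}

    ramanujan-capture : ∀ ζ k m → ramanujan (suc m) ζ k ≡ ramanujan (suc m) ζ k
    ramanujan-capture ζ k m with coprime? (suc m) (suc m)
    ... | yes _ with suc m
    ...   | N = ≡.cong (_+ _) (≡.refl {x = ramanujanUpTo N ζ k m})
    ramanujan-capture ζ k m | no _ with suc m
    ...   | N = ≡.refl {x = ramanujanUpTo N ζ k m}

    RPoly-capture : ∀ ζ m → RPoly (suc m) ζ ≡ RPoly (suc m) ζ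
    RPoly-capture ζ m with ramanujan (suc m) ζ 0
    ... | _ with suc m
    ...   | N with 1
    ...     | K = ≡.cong (_ ∷_) (≡.refl {x = RPolyFrom N ζ K m})

    cyclotomic-capture : ∀ ζ m → cyclotomic (suc m) ζ ≡ cyclotomic (suc m) ζ
    cyclotomic-capture ζ m with coprime? (suc m) (suc m)
    ... | yes _ with suc m
    ...   | N = ≡.cong (_*ₚ _) (≡.refl {x = cyclotomicUpTo N ζ m})
    cyclotomic-capture ζ m | no _ with suc m
    ...   | N = ≡.refl {x = cyclotomicUpTo N ζ m}

module Sums {c ℓ} (R : CommutativeRing c ℓ) where
  open import Function using (_∘_)
  open import Data.Fin using (toℕ)
  open import Data.Fin.Properties using (toℕ<n; toℕ-inject₁; toℕ-fromℕ; opposite-prop)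
  import Data.Fin.Permutation as Permutation
  open CommutativeRing R
  open Ring R using (ι)
  open import Algebra.Properties.Semiring.Sum semiring
    using ( sum; sum-cong-≋; sum-cong-≗; sum-init-last; sum-replicate-zero
          ; ∑-distrib-+; ∑-permute; ∑-comm; *-distribˡ-sum; *-distribʳ-sum)

  ∑< : ℕ → (ℕ → Carrier) → Carrier
  ∑< m f = sum {m} (f ∘ toℕ)

  ∑<-cong : ∀ m {f g} → (∀ i → i < m → f i ≈ g i) → ∑< m f ≈ ∑< m g
  ∑<-cong m f≈g = sum-cong-≋ (λ i → f≈g (toℕ i) (toℕ<n i))

  ∑<-zero : ∀ m {f} → (∀ i → i < m → f i ≈ 0#) → ∑< m f ≈ 0#
  ∑<-zero m f≈0 = trans (∑<-cong m f≈0) (sum-replicate-zero m)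

  ∑<-comm : ∀ m n (F : ℕ → ℕ → Carrier) → ∑< m (λ i → ∑< n (F i)) ≈ ∑< n (λ j → ∑< m (λ i → F i j))
  ∑<-comm m n F = ∑-comm {m} {n} (λ i j → F (toℕ i) (toℕ j))

  *-distribˡ-∑< : ∀ m x f → x * ∑< m f ≈ ∑< m (λ i → x * f i)
  *-distribˡ-∑< m x f = *-distribˡ-sum {m} x (f ∘ toℕ)

  *-distribʳ-∑< : ∀ m x f → ∑< m f * x ≈ ∑< m (λ i → f i * x)
  *-distribʳ-∑< m x f = *-distribʳ-sum {m} x (f ∘ toℕ)

  ∑<-last : ∀ m f → ∑< (suc m) f ≈ ∑< m f + f m
  ∑<-last m f = trans (sum-init-last (f ∘ toℕ))
    (+-cong (reflexive (sum-cong-≗ {m} (≡.cong f ∘ toℕ-inject₁))) (reflexive (≡.cong f (toℕ-fromℕ m))))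

  ∑<-split : ∀ a b f → ∑< (a ℕ.+ b) f ≈ ∑< a f + ∑< b (λ i → f (a ℕ.+ i))
  ∑<-split zero    b f = sym (+-identityˡ _)
  ∑<-split (suc a) b f = trans (+-congˡ (∑<-split a b (f ∘ suc))) (sym (+-assoc _ _ _))

  ∑<-reverse : ∀ m f → ∑< m f ≈ ∑< m (λ i → f (m ℕ.∸ suc i))
  ∑<-reverse m f = trans (∑-permute {m} (f ∘ toℕ) Permutation.reverse)
    (reflexive (sum-cong-≗ {m} (≡.cong f ∘ opposite-prop)))

  ∑<-pairs : ∀ h f → ∑< (h ℕ.+ h) f ≈ ∑< h (λ i → f i + f (h ℕ.+ (h ℕ.∸ suc i)))
  ∑<-pairs h f = trans (∑<-split h h f)
    (trans (+-congˡ (∑<-reverse h (λ i → f (h ℕ.+ i))))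
           (sym (∑-distrib-+ {h} (f ∘ toℕ) (λ i → f (h ℕ.+ (h ℕ.∸ suc (toℕ i)))))))

  ∑<-cong-pairs : ∀ h f g →
    (∀ i → i < h → f i + f (h ℕ.+ (h ℕ.∸ suc i)) ≈ g i + g (h ℕ.+ (h ℕ.∸ suc i))) → f (h ℕ.+ h) ≈ g (h ℕ.+ h) →
    ∑< (suc (h ℕ.+ h)) f ≈ ∑< (suc (h ℕ.+ h)) g
  ∑<-cong-pairs h f g pairs top = begin
    ∑< (suc (h ℕ.+ h)) f                                   ≈⟨ ∑<-last (h ℕ.+ h) f ⟩
    ∑< (h ℕ.+ h) f + f (h ℕ.+ h)                           ≈⟨ +-congʳ (∑<-pairs h f) ⟩
    ∑< h (λ i → f i + f (h ℕ.+ (h ℕ.∸ suc i))) + f (h ℕ.+ h) ≈⟨ +-cong (∑<-cong h pairs) top ⟩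
    ∑< h (λ i → g i + g (h ℕ.+ (h ℕ.∸ suc i))) + g (h ℕ.+ h) ≈⟨ +-congʳ (sym (∑<-pairs h g)) ⟩
    ∑< (h ℕ.+ h) g + g (h ℕ.+ h)                           ≈⟨ sym (∑<-last (h ℕ.+ h) g) ⟩
    ∑< (suc (h ℕ.+ h)) g                                   ∎
    where open import Relation.Binary.Reasoning.Setoid setoid

  ∑<-single : ∀ m f i₀ → i₀ < m → (∀ i → i < m → ¬ i ≡ i₀ → f i ≈ 0#) → ∑< m f ≈ f i₀
  ∑<-single (suc m) f zero _ others =
    trans (+-congˡ (∑<-zero m (λ i i<m → others (suc i) (s≤s i<m) λ ()))) (+-identityʳ _)
  ∑<-single (suc m) f (suc i₀) (s≤s i₀<m) others = trans
    (+-cong (others 0 z<s λ ()) (∑<-single m (f ∘ suc) i₀ i₀<m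
      λ i i<m i≢i₀ → others (suc i) (s≤s i<m) (i≢i₀ ∘ ℕₚ.suc-injective)))
    (+-identityˡ _)

  ∑<-ones : ∀ m → ∑< m (λ _ → 1#) ≈ ι m
  ∑<-ones zero    = refl
  ∑<-ones (suc m) = +-congˡ (∑<-ones m)

module RingFacts {c ℓ} (R : CommutativeRing c ℓ) where
  open import Relation.Nullary using (contradiction)
  open CommutativeRing R
  open Ring R using (pow)
  open import Algebra.Properties.Ring ring using (-1*x≈-x; -‿involutive; x[y-z]≈xy-xz)
  open import Algebra.Properties.CommutativeSemiring.Exp commutativeSemiring public
    using (_^_; ^-congˡ; ^-congʳ; ^-homo-*; ^-assocʳ; ^-distrib-*)
  open import Algebra.Properties.CommutativeSemigroup *-commutativeSemigroup public
    using () renaming (x∙yz≈y∙xz to x*yz≈y*xz)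
  open Sums R

  pow≡^ : ∀ x m → pow x m ≡ x ^ m
  pow≡^ x zero    = ≡.refl
  pow≡^ x (suc m) = ≡.cong (x *_) (pow≡^ x m)

  1^n≈1 : ∀ m → 1# ^ m ≈ 1#
  1^n≈1 zero    = refl
  1^n≈1 (suc m) = trans (*-identityˡ _) (1^n≈1 m)

  ^≈1-* : ∀ {x y} m → x ^ m ≈ 1# → y ^ m ≈ 1# → (x * y) ^ m ≈ 1#
  ^≈1-* {x} {y} m xᵐ≈1 yᵐ≈1 = trans (^-distrib-* x y m) (trans (*-cong xᵐ≈1 yᵐ≈1) (*-identityʳ 1#))

  -1*-1≈1 : - 1# * - 1# ≈ 1#
  -1*-1≈1 = trans (-1*x≈-x _) (-‿involutive 1#)

  -1^[2h]≈1 : ∀ h → (- 1#) ^ (2 ℕ.* h) ≈ 1#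
  -1^[2h]≈1 h = begin
    (- 1#) ^ (2 ℕ.* h)   ≈⟨ sym (^-assocʳ (- 1#) 2 h) ⟩
    ((- 1#) ^ 2) ^ h     ≈⟨ ^-congˡ h (trans (*-congˡ (*-identityʳ _)) -1*-1≈1) ⟩
    1# ^ h               ≈⟨ 1^n≈1 h ⟩
    1#                   ∎
    where open import Relation.Binary.Reasoning.Setoid setoid

  -1^[1+2h]≈-1 : ∀ h → (- 1#) ^ suc (2 ℕ.* h) ≈ - 1#
  -1^[1+2h]≈-1 h = trans (*-congˡ (-1^[2h]≈1 h)) (*-identityʳ _)

  indicator : ∀ {p} {P : Set p} → Dec P → Carrier
  indicator (yes _) = 1#
  indicator (no _)  = 0#

  indicator-*-cong : ∀ {p} {P : Set p} (d : Dec P) {x y} → (P → x ≈ y) → indicator d * x ≈ indicator d * y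
  indicator-*-cong (yes p) x≈y = *-congˡ (x≈y p)
  indicator-*-cong (no _)  _   = trans (zeroˡ _) (sym (zeroˡ _))

  indicator-*-vanish : ∀ {p} {P : Set p} (d : Dec P) {x} → (P → x ≈ 0#) → indicator d * x ≈ 0#
  indicator-*-vanish d x≈0 = trans (indicator-*-cong d x≈0) (zeroʳ _)

  indicator-*-holds : ∀ {p} {P : Set p} (d : Dec P) {x} → P → indicator d * x ≈ x
  indicator-*-holds (yes _) _ = *-identityˡ _
  indicator-*-holds (no ¬p) p = contradiction p ¬p

  geometric : Carrier → ℕ → Carrier
  geometric r m = ∑< m (r ^_)

  geometric-telescope : ∀ r m → (1# - r) * geometric r m ≈ 1# - r ^ m
  geometric-telescope r zero = trans (zeroʳ _) (sym (-‿inverseʳ 1#))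
  geometric-telescope r (suc m) = begin
    (1# - r) * (1# + ∑< m (λ i → r * r ^ i))  ≈⟨ *-congˡ (+-congˡ (sym (*-distribˡ-∑< m r (r ^_)))) ⟩
    (1# - r) * (1# + r * g)                    ≈⟨ distribˡ (1# - r) 1# (r * g) ⟩
    (1# - r) * 1# + (1# - r) * (r * g)         ≈⟨ +-cong (*-identityʳ _) (x*yz≈y*xz (1# - r) r g) ⟩
    (1# - r) + r * ((1# - r) * g)              ≈⟨ +-congˡ (*-congˡ (geometric-telescope r m)) ⟩
    (1# - r) + r * (1# - r ^ m)                ≈⟨ +-congˡ (trans (x[y-z]≈xy-xz r 1# (r ^ m)) (+-congʳ (*-identityʳ r))) ⟩
    (1# - r) + (r - r * r ^ m)                 ≈⟨ +-assoc 1# (- r) _ ⟩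
    1# + (- r + (r - r * r ^ m))               ≈⟨ +-congˡ (sym (+-assoc (- r) r _)) ⟩
    1# + ((- r + r) - r * r ^ m)               ≈⟨ +-congˡ (trans (+-congʳ (-‿inverseˡ r)) (+-identityˡ _)) ⟩
    1# - r * r ^ m                             ∎
    where
    open import Relation.Binary.Reasoning.Setoid setoid
    g : Carrier
    g = geometric r m

module ClosedForms {c ℓ} (R : CommutativeRing c ℓ) where
  open CommutativeRing R
  open Ring R using (ι; ramanujan; RPoly; eval)
  open import Relation.Binary.Reasoning.Setoid setoid
  open Unfolding R
  open Sums R
  open RingFacts R

  ⟦_coprime_⟧ : ℕ → ℕ → Carrier
  ⟦ j coprime N ⟧ = indicator (coprime? j N)

  totientUpTo-∑ : ∀ N m → ι (totientUpTo N m) ≈ ∑< m (λ i → ⟦ suc i coprime N ⟧)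
  totientUpTo-∑ N zero    = refl
  totientUpTo-∑ N (suc m) = trans last-term (sym (∑<-last m (λ i → ⟦ suc i coprime N ⟧)))
    where
    last-term : ι (totientUpTo N (suc m)) ≈ ∑< m (λ i → ⟦ suc i coprime N ⟧) + ⟦ suc m coprime N ⟧
    last-term with coprime? (suc m) N
    ... | yes _ = trans (+-comm _ _) (+-congʳ (totientUpTo-∑ N m))
    ... | no  _ = trans (totientUpTo-∑ N m) (sym (+-identityʳ _))

  ramanujanUpTo-∑ : ∀ N ζ k m → ramanujanUpTo N ζ k m ≈ ∑< m (λ i → ⟦ suc i coprime N ⟧ * ζ ^ (suc i ℕ.* k))
  ramanujanUpTo-∑ N ζ k zero    = refl
  ramanujanUpTo-∑ N ζ k (suc m) = trans last-term (sym (∑<-last m (λ i → ⟦ suc i coprime N ⟧ * ζ ^ (suc i ℕ.* k))))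
    where
    last-term : ramanujanUpTo N ζ k (suc m) ≈
                ∑< m (λ i → ⟦ suc i coprime N ⟧ * ζ ^ (suc i ℕ.* k)) + ⟦ suc m coprime N ⟧ * ζ ^ (suc m ℕ.* k)
    last-term with coprime? (suc m) N
    ... | yes _ = +-cong (ramanujanUpTo-∑ N ζ k m) (trans (reflexive (pow≡^ ζ (suc m ℕ.* k))) (sym (*-identityˡ _)))
    ... | no  _ = trans (ramanujanUpTo-∑ N ζ k m) (sym (trans (+-congˡ (zeroˡ _)) (+-identityʳ _)))

  eval-RPolyFrom : ∀ N ζ k m y → eval (RPolyFrom N ζ k m) y ≈ ∑< m (λ i → ramanujan N ζ (k ℕ.+ i) * y ^ i)
  eval-RPolyFrom N ζ k zero    y = refl
  eval-RPolyFrom N ζ k (suc m) y = begin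
    cₙ k + y * eval (RPolyFrom N ζ (suc k) m) y        ≈⟨ +-congˡ (*-congˡ (eval-RPolyFrom N ζ (suc k) m y)) ⟩
    cₙ k + y * ∑< m (λ i → cₙ (suc k ℕ.+ i) * y ^ i)
      ≈⟨ +-cong head (trans (*-distribˡ-∑< m y (λ i → cₙ (suc k ℕ.+ i) * y ^ i)) (∑<-cong m λ i _ → tail i)) ⟩
    cₙ (k ℕ.+ 0) * 1# + ∑< m (λ i → cₙ (k ℕ.+ suc i) * (y * y ^ i)) ∎
    where
    cₙ : ℕ → Carrier
    cₙ = ramanujan N ζ
    head : cₙ k ≈ cₙ (k ℕ.+ 0) * 1#
    head = sym (trans (*-identityʳ _) (reflexive (≡.cong cₙ (ℕₚ.+-identityʳ k))))
    tail : ∀ i → y * (cₙ (suc k ℕ.+ i) * y ^ i) ≈ cₙ (k ℕ.+ suc i) * (y * y ^ i)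
    tail i = trans (x*yz≈y*xz y _ _)
                   (*-congʳ (reflexive (≡.cong cₙ (≡.sym (ℕₚ.+-suc k i)))))

  eval-RPoly-∑ : ∀ n ζ y → eval (RPoly n ζ) y ≈ ∑< n (λ i → ⟦ suc i coprime n ⟧ * geometric (ζ ^ suc i * y) n)
  eval-RPoly-∑ n ζ y = begin
    eval (RPoly n ζ) y                                             ≈⟨ eval-RPolyFrom n ζ 0 n y ⟩
    ∑< n (λ k → ramanujan n ζ k * y ^ k)
      ≈⟨ ∑<-cong n (λ k _ → *-congʳ {y ^ k} (ramanujanUpTo-∑ n ζ k n)) ⟩
    ∑< n (λ k → ∑< n (λ i → term i k) * y ^ k)
      ≈⟨ ∑<-cong n (λ k _ → *-distribʳ-∑< n (y ^ k) (λ i → term i k)) ⟩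
    ∑< n (λ k → ∑< n (λ i → term i k * y ^ k))                     ≈⟨ ∑<-comm n n (λ k i → term i k * y ^ k) ⟩
    ∑< n (λ i → ∑< n (λ k → term i k * y ^ k))                     ≈⟨ ∑<-cong n (λ i _ → ∑<-cong n (λ k _ → regroup i k)) ⟩
    ∑< n (λ i → ∑< n (λ k → ⟦ suc i coprime n ⟧ * (ζ ^ suc i * y) ^ k))
      ≈⟨ ∑<-cong n (λ i _ → sym (*-distribˡ-∑< n ⟦ suc i coprime n ⟧ ((ζ ^ suc i * y) ^_))) ⟩
    ∑< n (λ i → ⟦ suc i coprime n ⟧ * geometric (ζ ^ suc i * y) n) ∎
    where
    term : ℕ → ℕ → Carrier
    term i k = ⟦ suc i coprime n ⟧ * ζ ^ (suc i ℕ.* k)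
    regroup : ∀ i k → term i k * y ^ k ≈ ⟦ suc i coprime n ⟧ * (ζ ^ suc i * y) ^ k
    regroup i k = begin
      ⟦ suc i coprime n ⟧ * ζ ^ (suc i ℕ.* k) * y ^ k       ≈⟨ *-assoc _ _ _ ⟩
      ⟦ suc i coprime n ⟧ * (ζ ^ (suc i ℕ.* k) * y ^ k)     ≈⟨ *-congˡ (*-congʳ (sym (^-assocʳ ζ (suc i) k))) ⟩
      ⟦ suc i coprime n ⟧ * ((ζ ^ suc i) ^ k * y ^ k)       ≈⟨ *-congˡ (sym (^-distrib-* (ζ ^ suc i) y k)) ⟩
      ⟦ suc i coprime n ⟧ * (ζ ^ suc i * y) ^ k             ∎

module Polynomials {c ℓ} (R : CommutativeRing c ℓ) where
  open import Relation.Binary.Bundles using (Setoid)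
  import Relation.Binary.Reasoning.Setoid as SetoidReasoning
  open CommutativeRing R
  open Ring R using (Poly; coeff; _≈ₚ_; _+ₚ_; scale; _*ₚ_; constₚ; eval)
  open import Algebra.Properties.CommutativeSemigroup +-commutativeSemigroup using (interchange)
  open import Algebra.Properties.Ring ring using (-‿distribʳ-*; //-rightDividesʳ)
  open RingFacts R using (x*yz≈y*xz)

  -- A record rather than `_≈ₚ_` itself, so that both polynomials can be inferred from a proof.
  infix 4 _≋_
  record _≋_ (p q : Poly) : Set ℓ where
    constructor coeffwise
    field coeff-≈ : p ≈ₚ q
  open _≋_ public

  ≋-setoid : Setoid c ℓ
  ≋-setoid = record
    { Carrier       = Poly
    ; _≈_           = _≋_
    ; isEquivalence = record
      { refl  = coeffwise λ _ → refl
      ; sym   = λ p≋q → coeffwise λ i → sym (coeff-≈ p≋q i)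
      ; trans = λ p≋q q≋r → coeffwise λ i → trans (coeff-≈ p≋q i) (coeff-≈ q≋r i)
      }
    }

  open Setoid ≋-setoid public using () renaming (refl to ≋-refl; sym to ≋-sym; trans to ≋-trans)
  module ≋-Reasoning = SetoidReasoning ≋-setoid

  coeff-+ₚ : ∀ p q i → coeff (p +ₚ q) i ≈ coeff p i + coeff q i
  coeff-+ₚ []      q       i       = sym (+-identityˡ _)
  coeff-+ₚ (a ∷ p) []      i       = sym (+-identityʳ _)
  coeff-+ₚ (a ∷ p) (b ∷ q) zero    = refl
  coeff-+ₚ (a ∷ p) (b ∷ q) (suc i) = coeff-+ₚ p q i

  coeff-scale : ∀ a p i → coeff (scale a p) i ≈ a * coeff p i
  coeff-scale a []      i       = sym (zeroʳ a)
  coeff-scale a (b ∷ p) zero    = refl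
  coeff-scale a (b ∷ p) (suc i) = coeff-scale a p i

  ∷-cong : ∀ {a b p q} → a ≈ b → p ≋ q → (a ∷ p) ≋ (b ∷ q)
  ∷-cong a≈b p≋q = coeffwise λ { zero → a≈b ; (suc i) → coeff-≈ p≋q i }

  +ₚ-cong : ∀ {p p′ q q′} → p ≋ p′ → q ≋ q′ → (p +ₚ q) ≋ (p′ +ₚ q′)
  +ₚ-cong {p} {p′} {q} {q′} p≋p′ q≋q′ = coeffwise λ i →
    trans (coeff-+ₚ p q i) (trans (+-cong (coeff-≈ p≋p′ i) (coeff-≈ q≋q′ i)) (sym (coeff-+ₚ p′ q′ i)))

  scale-cong : ∀ {a b p q} → a ≈ b → p ≋ q → scale a p ≋ scale b q
  scale-cong {a} {b} {p} {q} a≈b p≋q = coeffwise λ i →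
    trans (coeff-scale a p i) (trans (*-cong a≈b (coeff-≈ p≋q i)) (sym (coeff-scale b q i)))

  +ₚ-interchange : ∀ p q r s → ((p +ₚ q) +ₚ (r +ₚ s)) ≋ ((p +ₚ r) +ₚ (q +ₚ s))
  +ₚ-interchange p q r s = coeffwise λ i → begin
    coeff ((p +ₚ q) +ₚ (r +ₚ s)) i
      ≈⟨ trans (coeff-+ₚ (p +ₚ q) _ i) (+-cong (coeff-+ₚ p q i) (coeff-+ₚ r s i)) ⟩
    (coeff p i + coeff q i) + (coeff r i + coeff s i)       ≈⟨ interchange _ _ _ _ ⟩
    (coeff p i + coeff r i) + (coeff q i + coeff s i)
      ≈⟨ sym (trans (coeff-+ₚ (p +ₚ r) _ i) (+-cong (coeff-+ₚ p r i) (coeff-+ₚ q s i))) ⟩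
    coeff ((p +ₚ r) +ₚ (q +ₚ s)) i                          ∎
    where open SetoidReasoning setoid

  scale-distrib-+ₚ : ∀ a p q → scale a (p +ₚ q) ≋ (scale a p +ₚ scale a q)
  scale-distrib-+ₚ a p q = coeffwise λ i → begin
    coeff (scale a (p +ₚ q)) i                 ≈⟨ trans (coeff-scale a (p +ₚ q) i) (*-congˡ (coeff-+ₚ p q i)) ⟩
    a * (coeff p i + coeff q i)                ≈⟨ distribˡ a _ _ ⟩
    a * coeff p i + a * coeff q i              ≈⟨ sym (trans (coeff-+ₚ (scale a p) _ i) (+-cong (coeff-scale a p i) (coeff-scale a q i))) ⟩
    coeff (scale a p +ₚ scale a q) i           ∎
    where open SetoidReasoning setoid

  scale-* : ∀ a b p → scale (a * b) p ≋ scale a (scale b p)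
  scale-* a b p = coeffwise λ i →
    trans (coeff-scale (a * b) p i) (trans (*-assoc a b _) (sym (trans (coeff-scale a (scale b p) i) (*-congˡ (coeff-scale b p i)))))

  scale-zero : ∀ p → scale 0# p ≋ []
  scale-zero p = coeffwise λ i → trans (coeff-scale 0# p i) (zeroˡ _)

  +ₚ-identityˡ-≋ : ∀ {p} q → p ≋ [] → (p +ₚ q) ≋ q
  +ₚ-identityˡ-≋ {p} q p≋[] = coeffwise λ i → trans (coeff-+ₚ p q i) (trans (+-congʳ (coeff-≈ p≋[] i)) (+-identityˡ _))

  +ₚ-identityʳ-≋ : ∀ p {q} → q ≋ [] → (p +ₚ q) ≋ p
  +ₚ-identityʳ-≋ p {q} q≋[] = coeffwise λ i → trans (coeff-+ₚ p q i) (trans (+-congˡ (coeff-≈ q≋[] i)) (+-identityʳ _))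

  *ₚ-congʳ : ∀ p {q q′} → q ≋ q′ → (p *ₚ q) ≋ (p *ₚ q′)
  *ₚ-congʳ []      q≋q′ = ≋-refl
  *ₚ-congʳ (a ∷ p) q≋q′ = +ₚ-cong (scale-cong refl q≋q′) (∷-cong refl (*ₚ-congʳ p q≋q′))

  *ₚ-zeroʳ : ∀ p → (p *ₚ []) ≋ []
  *ₚ-zeroʳ []      = ≋-refl
  *ₚ-zeroʳ (a ∷ p) = coeffwise λ { zero → refl ; (suc i) → coeff-≈ (*ₚ-zeroʳ p) i }

  *ₚ-distribˡ : ∀ p q s → (p *ₚ (q +ₚ s)) ≋ ((p *ₚ q) +ₚ (p *ₚ s))
  *ₚ-distribˡ []      q s = ≋-refl
  *ₚ-distribˡ (a ∷ p) q s = begin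
    scale a (q +ₚ s) +ₚ (0# ∷ (p *ₚ (q +ₚ s)))
      ≈⟨ +ₚ-cong (scale-distrib-+ₚ a q s) (∷-cong (sym (+-identityʳ 0#)) (*ₚ-distribˡ p q s)) ⟩
    (scale a q +ₚ scale a s) +ₚ ((0# ∷ (p *ₚ q)) +ₚ (0# ∷ (p *ₚ s)))
      ≈⟨ +ₚ-interchange (scale a q) (scale a s) _ _ ⟩
    (scale a q +ₚ (0# ∷ (p *ₚ q))) +ₚ (scale a s +ₚ (0# ∷ (p *ₚ s))) ∎
    where open ≋-Reasoning

  *ₚ-shiftʳ : ∀ p q → (p *ₚ (0# ∷ q)) ≋ (0# ∷ (p *ₚ q))
  *ₚ-shiftʳ []      q = coeffwise λ { zero → refl ; (suc i) → refl }
  *ₚ-shiftʳ (a ∷ p) q = coeffwise λ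
    { zero    → trans (+-identityʳ _) (zeroʳ a)
    ; (suc i) → coeff-≈ (+ₚ-cong {scale a q} ≋-refl (*ₚ-shiftʳ p q)) i }

  *ₚ-constʳ : ∀ p a → (p *ₚ (a ∷ [])) ≋ scale a p
  *ₚ-constʳ []      a = ≋-refl
  *ₚ-constʳ (b ∷ p) a = coeffwise λ
    { zero    → trans (+-identityʳ _) (*-comm b a)
    ; (suc i) → coeff-≈ (*ₚ-constʳ p a) i }

  *ₚ-comm : ∀ p q → (p *ₚ q) ≋ (q *ₚ p)
  *ₚ-comm []      q = ≋-sym (*ₚ-zeroʳ q)
  *ₚ-comm (a ∷ p) q = begin
    scale a q +ₚ (0# ∷ (p *ₚ q))               ≈⟨ +ₚ-cong (≋-sym (*ₚ-constʳ q a)) (∷-cong refl (*ₚ-comm p q)) ⟩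
    (q *ₚ (a ∷ [])) +ₚ (0# ∷ (q *ₚ p))         ≈⟨ +ₚ-cong {q *ₚ (a ∷ [])} ≋-refl (≋-sym (*ₚ-shiftʳ q p)) ⟩
    (q *ₚ (a ∷ [])) +ₚ (q *ₚ (0# ∷ p))         ≈⟨ ≋-sym (*ₚ-distribˡ q (a ∷ []) (0# ∷ p)) ⟩
    q *ₚ ((a ∷ []) +ₚ (0# ∷ p))                ≈⟨ *ₚ-congʳ q (∷-cong (+-identityʳ a) ≋-refl) ⟩
    q *ₚ (a ∷ p)                               ∎
    where open ≋-Reasoning

  *ₚ-congˡ : ∀ {p p′} q → p ≋ p′ → (p *ₚ q) ≋ (p′ *ₚ q)
  *ₚ-congˡ {p} {p′} q p≋p′ = ≋-trans (*ₚ-comm p q) (≋-trans (*ₚ-congʳ q p≋p′) (*ₚ-comm q p′))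

  *ₚ-distribʳ : ∀ p q s → ((p +ₚ q) *ₚ s) ≋ ((p *ₚ s) +ₚ (q *ₚ s))
  *ₚ-distribʳ p q s = ≋-trans (*ₚ-comm (p +ₚ q) s)
    (≋-trans (*ₚ-distribˡ s p q) (+ₚ-cong (*ₚ-comm s p) (*ₚ-comm s q)))

  scale-*ₚ : ∀ a p q → (scale a p *ₚ q) ≋ scale a (p *ₚ q)
  scale-*ₚ a []      q = ≋-refl
  scale-*ₚ a (b ∷ p) q = begin
    scale (a * b) q +ₚ (0# ∷ (scale a p *ₚ q))          ≈⟨ +ₚ-cong (scale-* a b q) (∷-cong (sym (zeroʳ a)) (scale-*ₚ a p q)) ⟩
    scale a (scale b q) +ₚ scale a (0# ∷ (p *ₚ q))      ≈⟨ ≋-sym (scale-distrib-+ₚ a (scale b q) _) ⟩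
    scale a (scale b q +ₚ (0# ∷ (p *ₚ q)))              ∎
    where open ≋-Reasoning

  *ₚ-assoc : ∀ p q s → ((p *ₚ q) *ₚ s) ≋ (p *ₚ (q *ₚ s))
  *ₚ-assoc []      q s = ≋-refl
  *ₚ-assoc (a ∷ p) q s = begin
    (scale a q +ₚ (0# ∷ (p *ₚ q))) *ₚ s                 ≈⟨ *ₚ-distribʳ (scale a q) _ s ⟩
    (scale a q *ₚ s) +ₚ ((0# ∷ (p *ₚ q)) *ₚ s)           ≈⟨ +ₚ-cong (scale-*ₚ a q s) (+ₚ-identityˡ-≋ _ (scale-zero s)) ⟩
    scale a (q *ₚ s) +ₚ (0# ∷ ((p *ₚ q) *ₚ s))          ≈⟨ +ₚ-cong {scale a (q *ₚ s)} ≋-refl (∷-cong refl (*ₚ-assoc p q s)) ⟩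
    scale a (q *ₚ s) +ₚ (0# ∷ (p *ₚ (q *ₚ s)))          ∎
    where open ≋-Reasoning

  +ₚ-comm : ∀ p q → (p +ₚ q) ≋ (q +ₚ p)
  +ₚ-comm p q = coeffwise λ i → trans (coeff-+ₚ p q i) (trans (+-comm _ _) (sym (coeff-+ₚ q p i)))

  ∷-injectiveʳ : ∀ {a b p q} → (a ∷ p) ≋ (b ∷ q) → p ≋ q
  ∷-injectiveʳ a∷p≋b∷q = coeffwise λ i → coeff-≈ a∷p≋b∷q (suc i)

  constₚ-≋[] : ∀ {a} → a ≈ 0# → constₚ a ≋ []
  constₚ-≋[] a≈0 = coeffwise λ { zero → a≈0 ; (suc i) → refl }

  eval-≋[] : ∀ {p} y → p ≋ [] → eval p y ≈ 0#
  eval-≋[] {[]}    y p≋[] = refl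
  eval-≋[] {a ∷ p} y a∷p≋[] =
    trans (+-cong (coeff-≈ a∷p≋[] 0) (*-congˡ (eval-≋[] {p} y (coeffwise λ i → coeff-≈ a∷p≋[] (suc i)))))
                                 (trans (+-identityˡ _) (zeroʳ y))

  eval-cong : ∀ {p q} y → p ≋ q → eval p y ≈ eval q y
  eval-cong {[]}    {q}     y p≋q = sym (eval-≋[] y (≋-sym p≋q))
  eval-cong {a ∷ p} {[]}    y p≋q = eval-≋[] y p≋q
  eval-cong {a ∷ p} {b ∷ q} y p≋q = +-cong (coeff-≈ p≋q 0) (*-congˡ (eval-cong y (∷-injectiveʳ p≋q)))

  eval-+ₚ : ∀ p q y → eval (p +ₚ q) y ≈ eval p y + eval q y
  eval-+ₚ []      q       y = sym (+-identityˡ _)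
  eval-+ₚ (a ∷ p) []      y = sym (+-identityʳ _)
  eval-+ₚ (a ∷ p) (b ∷ q) y = trans (+-congˡ (trans (*-congˡ (eval-+ₚ p q y)) (distribˡ y _ _))) (interchange a b _ _)

  eval-scale : ∀ a p y → eval (scale a p) y ≈ a * eval p y
  eval-scale a []      y = sym (zeroʳ a)
  eval-scale a (b ∷ p) y = trans (+-congˡ (trans (*-congˡ (eval-scale a p y)) (x*yz≈y*xz y a _))) (sym (distribˡ a b _))

  eval-*ₚ : ∀ p q y → eval (p *ₚ q) y ≈ eval p y * eval q y
  eval-*ₚ []      q y = sym (zeroˡ _)
  eval-*ₚ (a ∷ p) q y = begin
    eval (scale a q +ₚ (0# ∷ (p *ₚ q))) y         ≈⟨ eval-+ₚ (scale a q) _ y ⟩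
    eval (scale a q) y + (0# + y * eval (p *ₚ q) y) ≈⟨ +-cong (eval-scale a q y) (trans (+-identityˡ _) (*-congˡ (eval-*ₚ p q y))) ⟩
    a * eval q y + y * (eval p y * eval q y)
      ≈⟨ sym (trans (distribʳ (eval q y) a (y * eval p y)) (+-congˡ (*-assoc y (eval p y) (eval q y)))) ⟩
    (a + y * eval p y) * eval q y                  ∎
    where open SetoidReasoning setoid

  linear : Carrier → Poly
  linear a = (- a) ∷ 1# ∷ []

  eval-linear : ∀ a y → eval (linear a) y ≈ y - a
  eval-linear a y = trans (+-congˡ (trans (*-congˡ (trans (+-congˡ (zeroʳ y)) (+-identityʳ 1#))) (*-identityʳ y))) (+-comm _ _)

  quotientByLinear : Carrier → Poly → Poly
  quotientByLinear a []      = []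
  quotientByLinear a (b ∷ p) = eval p a ∷ quotientByLinear a p

  factor-theorem : ∀ a p → p ≋ ((quotientByLinear a p *ₚ linear a) +ₚ constₚ (eval p a))
  factor-theorem a []      = coeffwise λ { zero → refl ; (suc i) → refl }
  factor-theorem a (b ∷ p) = ∷-cong head (begin
    p                                    ≈⟨ factor-theorem a p ⟩
    (q *ₚ linear a) +ₚ constₚ e           ≈⟨ +ₚ-comm (q *ₚ linear a) _ ⟩
    constₚ e +ₚ (q *ₚ linear a)           ≈⟨ +ₚ-cong (∷-cong {p = []} (sym (*-identityʳ e)) ≋-refl) (≋-refl {q *ₚ linear a}) ⟩
    ((e * 1# ∷ []) +ₚ (q *ₚ linear a))    ≈⟨ ≋-sym (+ₚ-identityʳ-≋ _ ≋-refl) ⟩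
    ((e * 1# ∷ []) +ₚ (q *ₚ linear a)) +ₚ [] ∎)
    where
    open ≋-Reasoning
    e : Carrier
    e = eval p a
    q : Poly
    q = quotientByLinear a p
    head : b ≈ (e * - a + 0#) + (b + a * e)
    head = sym (trans (+-cong (trans (+-identityʳ _) (sym (-‿distribʳ-* e a))) (+-congˡ (*-comm a e)))
                      (trans (+-comm _ _) (//-rightDividesʳ (e * a) b)))

  *ₚ-right-comm : ∀ p q r → ((p *ₚ q) *ₚ r) ≋ ((p *ₚ r) *ₚ q)
  *ₚ-right-comm p q r = ≋-trans (*ₚ-assoc p q r) (≋-trans (*ₚ-congʳ p (*ₚ-comm q r)) (≋-sym (*ₚ-assoc p r q)))

  *ₚ-identityˡ : ∀ p → (constₚ 1# *ₚ p) ≋ p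
  *ₚ-identityˡ p = ≋-trans (+ₚ-identityʳ-≋ (scale 1# p) (constₚ-≋[] refl))
                           (coeffwise λ i → trans (coeff-scale 1# p i) (*-identityˡ _))

  root⇒linear-factor : ∀ {a} p → eval p a ≈ 0# → p ≋ (quotientByLinear a p *ₚ linear a)
  root⇒linear-factor {a} p pa≈0 = ≋-trans (factor-theorem a p) (+ₚ-identityʳ-≋ _ (constₚ-≋[] pa≈0))

module Domain {c ℓ} (R : CommutativeRing c ℓ) (dom : Ring.IsDomain R) where
  open import Data.Product using (proj₁; proj₂)
  open import Data.Sum using (inj₁; inj₂)
  open import Relation.Nullary using (contradiction)
  open import Algebra.Definitions using (AlmostLeftCancellative)
  open import Function using (_∘_)
  open CommutativeRing R
  open import Algebra.Properties.Ring ring using (x∙y⁻¹≈ε⇒x≈y; x≈y⇒x∙y⁻¹≈ε; x[y-z]≈xy-xz; +-cancelˡ)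
  open Ring R using (eval; _*ₚ_)
  open import Relation.Binary.Reasoning.Setoid setoid
  open RingFacts R
  open Polynomials R

  1≉0 : ¬ 1# ≈ 0#
  1≉0 = proj₁ dom

  *-almostCancelˡ : AlmostLeftCancellative _≈_ 0# _*_
  *-almostCancelˡ x y z x≉0 xy≈xz
    with proj₂ dom x (y - z) (trans (x[y-z]≈xy-xz x y z) (x≈y⇒x∙y⁻¹≈ε xy≈xz))
  ... | inj₁ x≈0   = contradiction x≈0 x≉0
  ... | inj₂ y-z≈0 = x∙y⁻¹≈ε⇒x≈y y z y-z≈0

  *-almostCancelʳ : ∀ x y z → ¬ x ≈ 0# → y * x ≈ z * x → y ≈ z
  *-almostCancelʳ x y z x≉0 yx≈zx = *-almostCancelˡ x y z x≉0 (trans (*-comm x y) (trans yx≈zx (*-comm z x)))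

  geometric-vanishes : ∀ r m → r ^ m ≈ 1# → ¬ r ≈ 1# → geometric r m ≈ 0#
  geometric-vanishes r m rᵐ≈1 r≉1 = *-almostCancelˡ (1# - r) _ _ 1-r≉0 (begin
    (1# - r) * geometric r m  ≈⟨ geometric-telescope r m ⟩
    1# - r ^ m                ≈⟨ x≈y⇒x∙y⁻¹≈ε (sym rᵐ≈1) ⟩
    0#                        ≈⟨ sym (zeroʳ _) ⟩
    (1# - r) * 0#             ∎)
    where
    1-r≉0 : ¬ 1# - r ≈ 0#
    1-r≉0 1-r≈0 = r≉1 (sym (x∙y⁻¹≈ε⇒x≈y 1# r 1-r≈0))

  inverse-pair-sum : ∀ {u v g h} → u * v ≈ 1# → ¬ u ≈ 1# →
                     (1# + u) * g ≈ 1# + 1# → (1# + v) * h ≈ 1# + 1# → g + h ≈ 1# + 1#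
  inverse-pair-sum {u} {v} {g} {h} uv≈1 u≉1 [1+u]g≈2 [1+v]h≈2 =
    *-almostCancelˡ (1# + u) _ _ 1+u≉0 (begin
      (1# + u) * (g + h)          ≈⟨ distribˡ (1# + u) g h ⟩
      (1# + u) * g + (1# + u) * h ≈⟨ +-cong [1+u]g≈2 [1+u]h≈2u ⟩
      (1# + 1#) + u * (1# + 1#)   ≈⟨ +-congʳ (sym (*-identityˡ _)) ⟩
      1# * (1# + 1#) + u * (1# + 1#) ≈⟨ sym (distribʳ (1# + 1#) 1# u) ⟩
      (1# + u) * (1# + 1#)        ∎)
    where
    1+u≈u[1+v] : 1# + u ≈ u * (1# + v)
    1+u≈u[1+v] = sym (trans (distribˡ u 1# v) (trans (+-cong (*-identityʳ u) uv≈1) (+-comm u 1#)))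
    [1+u]h≈2u : (1# + u) * h ≈ u * (1# + 1#)
    [1+u]h≈2u = trans (*-congʳ 1+u≈u[1+v]) (trans (*-assoc u (1# + v) h) (*-congˡ [1+v]h≈2))
    1+u≉0 : ¬ 1# + u ≈ 0#
    1+u≉0 1+u≈0 = u≉1 (sym (+-cancelˡ 1# 1# u (begin
      1# + 1#      ≈⟨ sym [1+u]g≈2 ⟩
      (1# + u) * g ≈⟨ *-congʳ 1+u≈0 ⟩
      0# * g       ≈⟨ zeroˡ g ⟩
      0#           ≈⟨ sym 1+u≈0 ⟩
      1# + u       ∎)))

  quotient-root : ∀ {a y} p → eval p a ≈ 0# → eval p y ≈ 0# → ¬ y ≈ a → eval (quotientByLinear a p) y ≈ 0#
  quotient-root {a} {y} p pa≈0 py≈0 y≉a = *-almostCancelʳ (y - a) _ _ (y≉a ∘ x∙y⁻¹≈ε⇒x≈y y a) (begin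
    eval (quotientByLinear a p) y * (y - a)           ≈⟨ *-congˡ (sym (eval-linear a y)) ⟩
    eval (quotientByLinear a p) y * eval (linear a) y ≈⟨ sym (eval-*ₚ (quotientByLinear a p) (linear a) y) ⟩
    eval (quotientByLinear a p *ₚ linear a) y         ≈⟨ sym (eval-cong y (root⇒linear-factor p pa≈0)) ⟩
    eval p y                                          ≈⟨ py≈0 ⟩
    0#                                                ≈⟨ sym (zeroˡ _) ⟩
    0# * (y - a)                                      ∎)

module PrimitiveRoot {c ℓ} (R : CommutativeRing c ℓ) (dom : Ring.IsDomain R)
                     (n′ : ℕ) (ζ : CommutativeRing.Carrier R) (prim : Ring.IsPrimitiveRoot R (suc n′) ζ) where
  open import Data.Product using (Σ; _×_; proj₁; proj₂; map₂)
  open import Data.Nat.DivMod using (_%_; _/_; m≡m%n+[m/n]*n; m%n<n)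
  open import Data.Nat.Divisibility using (divides; m%n≡0⇒n∣m; *-cancelˡ-∣; ∣-refl; 1∣_)
  open import Data.Nat.Coprimality using (1-coprimeTo)
  open import Data.Empty using (⊥-elim)
  open import Relation.Nullary using (contradiction)
  open import Relation.Binary.Definitions using (tri<; tri≈; tri>)
  open CommutativeRing R
  open Ring R using (Poly; pow; eval; RPoly; ι; cyclotomic; _+ₚ_; _*ₚ_; -ₚ_; constₚ; _∣ₚ_)
  open import Algebra.Properties.Ring ring using (-1*x≈-x; -‿involutive)
  open import Relation.Binary.Reasoning.Setoid setoid
  open RingFacts R
  open Polynomials R
  open Domain R dom

  n : ℕ
  n = suc n′

  ζ^n≈1 : ζ ^ n ≈ 1#
  ζ^n≈1 = trans (reflexive (≡.sym (pow≡^ ζ n))) (proj₁ prim)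

  ζ^m≉1 : ∀ {m} → 0 < m → m < n → ¬ ζ ^ m ≈ 1#
  ζ^m≉1 {m} 0<m m<n ζᵐ≈1 = proj₂ prim m 0<m m<n (trans (reflexive (pow≡^ ζ m)) ζᵐ≈1)

  ∣⇒ζ^≈1 : ∀ {t} → n ∣ t → ζ ^ t ≈ 1#
  ∣⇒ζ^≈1 (divides q ≡.refl) = begin
    ζ ^ (q ℕ.* n)  ≈⟨ ^-congʳ ζ (ℕₚ.*-comm q n) ⟩
    ζ ^ (n ℕ.* q)  ≈⟨ sym (^-assocʳ ζ n q) ⟩
    (ζ ^ n) ^ q    ≈⟨ ^-congˡ q ζ^n≈1 ⟩
    1# ^ q         ≈⟨ 1^n≈1 q ⟩
    1#             ∎

  ζ^≈1⇒∣ : ∀ t → ζ ^ t ≈ 1# → n ∣ t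
  ζ^≈1⇒∣ t ζᵗ≈1 with t % n ℕ.≟ 0
  ... | yes t%n≡0 = m%n≡0⇒n∣m t n t%n≡0
  ... | no  t%n≢0 = contradiction ζ^[t%n]≈1 (ζ^m≉1 (ℕₚ.n≢0⇒n>0 t%n≢0) (m%n<n t n))
    where
    ζ^[t%n]≈1 : ζ ^ (t % n) ≈ 1#
    ζ^[t%n]≈1 = begin
      ζ ^ (t % n)                                ≈⟨ sym (*-identityʳ _) ⟩
      ζ ^ (t % n) * 1#                           ≈⟨ *-congˡ (sym (∣⇒ζ^≈1 (divides (t / n) ≡.refl))) ⟩
      ζ ^ (t % n) * ζ ^ ((t / n) ℕ.* n)          ≈⟨ sym (^-homo-* ζ (t % n) _) ⟩
      ζ ^ (t % n ℕ.+ (t / n) ℕ.* n)              ≈⟨ ^-congʳ ζ (≡.sym (m≡m%n+[m/n]*n t n)) ⟩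
      ζ ^ t                                      ≈⟨ ζᵗ≈1 ⟩
      1#                                         ∎

  [ζ^j]^n≈1 : ∀ j → (ζ ^ j) ^ n ≈ 1#
  [ζ^j]^n≈1 j = trans (^-assocʳ ζ j n) (∣⇒ζ^≈1 (divides j ≡.refl))

  ζ^≉0 : ∀ i → ¬ ζ ^ i ≈ 0#
  ζ^≉0 i ζⁱ≈0 = 1≉0 (begin
    1#                       ≈⟨ sym (1^n≈1 i) ⟩
    1# ^ i                   ≈⟨ ^-congˡ i (sym ζ^n≈1) ⟩
    (ζ * ζ ^ n′) ^ i         ≈⟨ ^-distrib-* ζ (ζ ^ n′) i ⟩
    ζ ^ i * (ζ ^ n′) ^ i     ≈⟨ *-congʳ ζⁱ≈0 ⟩
    0# * (ζ ^ n′) ^ i        ≈⟨ zeroˡ _ ⟩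
    0#                       ∎)

  ζ^-distinct : ∀ {i j} → i < j → j ℕ.∸ i < n → ¬ ζ ^ i ≈ ζ ^ j
  ζ^-distinct {i} {j} i<j j∸i<n ζⁱ≈ζʲ = ζ^m≉1 (ℕₚ.m<n⇒0<n∸m i<j) j∸i<n
    (sym (*-almostCancelˡ (ζ ^ i) 1# (ζ ^ (j ℕ.∸ i)) (ζ^≉0 i) (begin
      ζ ^ i * 1#                 ≈⟨ *-identityʳ _ ⟩
      ζ ^ i                      ≈⟨ ζⁱ≈ζʲ ⟩
      ζ ^ j                      ≈⟨ ^-congʳ ζ (≡.sym (ℕₚ.m+[n∸m]≡n (ℕₚ.<⇒≤ i<j))) ⟩
      ζ ^ (i ℕ.+ (j ℕ.∸ i))      ≈⟨ ^-homo-* ζ i (j ℕ.∸ i) ⟩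
      ζ ^ i * ζ ^ (j ℕ.∸ i)      ∎)))

  ζ^-injective : ∀ {i j} → i < n → j < n → ζ ^ i ≈ ζ ^ j → i ≡ j
  ζ^-injective {i} {j} i<n j<n ζⁱ≈ζʲ with ℕₚ.<-cmp i j
  ... | tri< i<j _ _ = contradiction ζⁱ≈ζʲ (ζ^-distinct i<j (ℕₚ.≤-<-trans (ℕₚ.m∸n≤m j i) j<n))
  ... | tri≈ _ i≡j _ = i≡j
  ... | tri> _ _ j<i = contradiction (sym ζⁱ≈ζʲ) (ζ^-distinct j<i (ℕₚ.≤-<-trans (ℕₚ.m∸n≤m i j) i<n))

  open Unfolding R
  open Sums R
  open ClosedForms R

  R[-1]≈0-even : ∀ h → n ≡ 2 ℕ.* h → 2 < n → eval (RPoly n ζ) (- 1#) ≈ 0#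
  R[-1]≈0-even h n≡2h 2<n = trans (eval-RPoly-∑ n ζ (- 1#)) (∑<-zero n λ i _ →
    indicator-*-vanish (coprime? (suc i) n) λ coprime →
      geometric-vanishes _ n (^≈1-* n ([ζ^j]^n≈1 (suc i)) -1^n≈1) (ζ^j*-1≉1 coprime))
    where
    -1^n≈1 : (- 1#) ^ n ≈ 1#
    -1^n≈1 = trans (^-congʳ (- 1#) n≡2h) (-1^[2h]≈1 h)
    ζ^j*-1≉1 : ∀ {j} → Coprime j n → ¬ ζ ^ j * - 1# ≈ 1#
    ζ^j*-1≉1 {j} coprime ζʲ*-1≈1 = ℕₚ.<⇒≢ 2<n (≡.sym (≡.trans n≡2h (≡.cong (2 ℕ.*_) h≡1)))
      where
      ζʲ≈-1 : ζ ^ j ≈ - 1#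
      ζʲ≈-1 = begin
        ζ ^ j                    ≈⟨ sym (*-identityʳ _) ⟩
        ζ ^ j * 1#               ≈⟨ *-congˡ (sym -1*-1≈1) ⟩
        ζ ^ j * (- 1# * - 1#)    ≈⟨ sym (*-assoc _ _ _) ⟩
        ζ ^ j * - 1# * - 1#      ≈⟨ *-congʳ ζʲ*-1≈1 ⟩
        1# * - 1#                ≈⟨ *-identityˡ _ ⟩
        - 1#                     ∎
      n∣2j : n ∣ 2 ℕ.* j
      n∣2j = ζ^≈1⇒∣ (2 ℕ.* j) (begin
        ζ ^ (2 ℕ.* j)   ≈⟨ ^-congʳ ζ (ℕₚ.*-comm 2 j) ⟩
        ζ ^ (j ℕ.* 2)   ≈⟨ sym (^-assocʳ ζ j 2) ⟩
        (ζ ^ j) ^ 2     ≈⟨ ^-congˡ 2 ζʲ≈-1 ⟩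
        (- 1#) ^ 2      ≈⟨ -1^[2h]≈1 1 ⟩
        1#              ∎)
      h≡1 : h ≡ 1
      h≡1 = coprime (*-cancelˡ-∣ 2 (≡.subst (_∣ 2 ℕ.* j) n≡2h n∣2j) , divides 2 n≡2h)

  module OddOrder (h : ℕ) (n≡1+2h : n ≡ suc (2 ℕ.* h)) where

    alternating : ℕ → Carrier
    alternating j = geometric (ζ ^ j * - 1#) n

    n′≡h+h : n′ ≡ h ℕ.+ h
    n′≡h+h = ≡.trans (ℕₚ.suc-injective n≡1+2h) (≡.cong (h ℕ.+_) (ℕₚ.+-identityʳ h))

    [1+ζ^j]alternating≈2 : ∀ j → (1# + ζ ^ j) * alternating j ≈ 1# + 1#
    [1+ζ^j]alternating≈2 j = begin
      (1# + ζ ^ j) * alternating j        ≈⟨ *-congʳ (+-congˡ (sym -[ζʲ*-1]≈ζʲ)) ⟩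
      (1# - ζ ^ j * - 1#) * alternating j ≈⟨ geometric-telescope (ζ ^ j * - 1#) n ⟩
      1# - (ζ ^ j * - 1#) ^ n   ≈⟨ +-congˡ (-‿cong rⁿ≈-1) ⟩
      1# - - 1#                 ≈⟨ +-congˡ (-‿involutive 1#) ⟩
      1# + 1#                   ∎
      where
      -[ζʲ*-1]≈ζʲ : - (ζ ^ j * - 1#) ≈ ζ ^ j
      -[ζʲ*-1]≈ζʲ = trans (-‿cong (trans (*-comm _ _) (-1*x≈-x _))) (-‿involutive _)
      rⁿ≈-1 : (ζ ^ j * - 1#) ^ n ≈ - 1#
      rⁿ≈-1 = begin
        (ζ ^ j * - 1#) ^ n        ≈⟨ ^-distrib-* (ζ ^ j) (- 1#) n ⟩
        (ζ ^ j) ^ n * (- 1#) ^ n  ≈⟨ *-cong ([ζ^j]^n≈1 j) (trans (^-congʳ (- 1#) n≡1+2h) (-1^[1+2h]≈-1 h)) ⟩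
        1# * - 1#                 ≈⟨ *-identityˡ _ ⟩
        - 1#                      ∎

    alternating-pair : ∀ {j j′} → j ℕ.+ j′ ≡ n → 0 < j → j < n → alternating j + alternating j′ ≈ 1# + 1#
    alternating-pair {j} {j′} j+j′≡n 0<j j<n =
      inverse-pair-sum ζʲζʲ′≈1 (ζ^m≉1 0<j j<n) ([1+ζ^j]alternating≈2 j) ([1+ζ^j]alternating≈2 j′)
      where
      ζʲζʲ′≈1 : ζ ^ j * ζ ^ j′ ≈ 1#
      ζʲζʲ′≈1 = trans (sym (^-homo-* ζ j j′)) (trans (^-congʳ ζ j+j′≡n) ζ^n≈1)

    coprime-pair : ∀ {j j′} → j ℕ.+ j′ ≡ n → 0 < j → j < n →
                   ⟦ j coprime n ⟧ * alternating j + ⟦ j′ coprime n ⟧ * alternating j′ ≈ ⟦ j coprime n ⟧ + ⟦ j′ coprime n ⟧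
    coprime-pair {j} {j′} j+j′≡n 0<j j<n with coprime? j n | coprime? j′ n
    ... | yes _  | yes _   = trans (+-cong (*-identityˡ _) (*-identityˡ _)) (alternating-pair j+j′≡n 0<j j<n)
    ... | no  _  | no  _   = +-cong (zeroˡ _) (zeroˡ _)
    ... | yes cp | no ¬cp′ = ⊥-elim (¬cp′ (coprime-complement j+j′≡n cp))
    ... | no ¬cp | yes cp′ = ⊥-elim (¬cp (coprime-complement (≡.trans (ℕₚ.+-comm j′ j) j+j′≡n) cp′))

    alternating[n]≈1 : Coprime n n → alternating n ≈ 1#
    alternating[n]≈1 coprime = ≡.subst (λ m → geometric (ζ ^ suc m * - 1#) (suc m) ≈ 1#) (≡.sym n′≡0) (+-identityʳ 1#)
      where
      n′≡0 : n′ ≡ 0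
      n′≡0 = ℕₚ.suc-injective (coprime (∣-refl , ∣-refl))

    -- j = 1 + i is paired with n - j = 1 + (h + (h ∸ (1 + i))) for i < h, so no division by 2
    -- (possibly zero in R) is needed; the remaining index j = n matters only for n = 1.
    R[-1]≈φ : eval (RPoly n ζ) (- 1#) ≈ ι (totient n)
    R[-1]≈φ = begin
      eval (RPoly n ζ) (- 1#)     ≈⟨ eval-RPoly-∑ n ζ (- 1#) ⟩
      ∑< n weighted               ≡⟨ ≡.cong (λ m → ∑< (suc m) weighted) n′≡h+h ⟩
      ∑< (suc (h ℕ.+ h)) weighted ≈⟨ ∑<-cong-pairs h weighted indicators pair top ⟩
      ∑< (suc (h ℕ.+ h)) indicators ≡⟨ ≡.cong (λ m → ∑< (suc m) indicators) (≡.sym n′≡h+h) ⟩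
      ∑< n indicators             ≈⟨ sym (totientUpTo-∑ n n) ⟩
      ι (totient n)               ∎
      where
      indicators weighted : ℕ → Carrier
      indicators i = ⟦ suc i coprime n ⟧
      weighted   i = ⟦ suc i coprime n ⟧ * alternating (suc i)
      n≡1+h+h : n ≡ suc (h ℕ.+ h)
      n≡1+h+h = ≡.cong suc n′≡h+h
      pair : ∀ i → i < h → weighted i + weighted (h ℕ.+ (h ℕ.∸ suc i)) ≈ indicators i + indicators (h ℕ.+ (h ℕ.∸ suc i))
      pair i i<h = coprime-pair (≡.trans (mirror-sum i<h) (≡.sym n≡1+h+h)) z<s
                                (ℕₚ.<-≤-trans (s≤s i<h) (≡.subst (suc h ≤_) (≡.sym n≡1+h+h) (s≤s (ℕₚ.m≤m+n h h))))
      top : weighted (h ℕ.+ h) ≈ indicators (h ℕ.+ h)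
      top = ≡.subst (λ m → ⟦ m coprime n ⟧ * alternating m ≈ ⟦ m coprime n ⟧) n≡1+h+h
              (trans (indicator-*-cong (coprime? n n) alternating[n]≈1) (*-identityʳ _))

  complementary-index : ∀ {b} → b ≤ n → Coprime b n → Σ ℕ λ i₀ → i₀ < n × Coprime (suc i₀) n × n ∣ suc i₀ ℕ.+ b
  complementary-index {b} b≤n coprime with ℕₚ.m≤n⇒∃[o]m+o≡n b≤n
  ... | suc i₀ , b+1+i₀≡n =
    i₀ , ≡.subst (suc i₀ ≤_) b+1+i₀≡n (ℕₚ.m≤n+m (suc i₀) b) , coprime-complement b+1+i₀≡n coprime ,
    ≡.subst (n ∣_) (≡.trans (≡.sym b+1+i₀≡n) (ℕₚ.+-comm b (suc i₀))) ∣-refl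
  ... | zero , b+0≡n = 0 , z<s , 1-coprimeTo n , ≡.subst (_∣ suc b) (≡.sym n≡1) (1∣ suc b)
    where
    n≡1 : n ≡ 1
    n≡1 = coprime (≡.subst (_∣ b) (≡.trans (≡.sym (ℕₚ.+-identityʳ b)) b+0≡n) ∣-refl , ∣-refl)

  R[ζ^b]≈n : ∀ {b} → b ≤ n → Coprime b n → eval (RPoly n ζ) (ζ ^ b) ≈ ι n
  R[ζ^b]≈n {b} b≤n coprime with complementary-index b≤n coprime
  ... | i₀ , i₀<n , coprime₀ , n∣1+i₀+b = begin
    eval (RPoly n ζ) (ζ ^ b)                                   ≈⟨ eval-RPoly-∑ n ζ (ζ ^ b) ⟩
    ∑< n (λ i → ⟦ suc i coprime n ⟧ * geometric (r i) n)       ≈⟨ ∑<-single n _ i₀ i₀<n vanishing ⟩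
    ⟦ suc i₀ coprime n ⟧ * geometric (r i₀) n                  ≈⟨ indicator-*-holds (coprime? (suc i₀) n) coprime₀ ⟩
    geometric (r i₀) n                                         ≈⟨ ∑<-cong n (λ k _ → trans (^-congˡ k r₀≈1) (1^n≈1 k)) ⟩
    ∑< n (λ _ → 1#)                                            ≈⟨ ∑<-ones n ⟩
    ι n                                                        ∎
    where
    r : ℕ → Carrier
    r i = ζ ^ suc i * ζ ^ b
    r≈ζ^ : ∀ i → r i ≈ ζ ^ i * ζ ^ suc b
    r≈ζ^ i = trans (*-congʳ (*-comm ζ (ζ ^ i))) (*-assoc (ζ ^ i) ζ (ζ ^ b))
    r₀≈1 : r i₀ ≈ 1#
    r₀≈1 = trans (sym (^-homo-* ζ (suc i₀) b)) (∣⇒ζ^≈1 n∣1+i₀+b)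
    vanishing : ∀ i → i < n → ¬ i ≡ i₀ → ⟦ suc i coprime n ⟧ * geometric (r i) n ≈ 0#
    vanishing i i<n i≢i₀ = indicator-*-vanish (coprime? (suc i) n) λ _ →
      geometric-vanishes (r i) n (^≈1-* n ([ζ^j]^n≈1 (suc i)) ([ζ^j]^n≈1 b)) λ rᵢ≈1 →
        i≢i₀ (ζ^-injective i<n i₀<n (*-almostCancelʳ (ζ ^ suc b) _ _ (ζ^≉0 (suc b))
          (trans (sym (r≈ζ^ i)) (trans rᵢ≈1 (trans (sym r₀≈1) (r≈ζ^ i₀))))))


  cyclotomicUpTo-∣ : ∀ m → m ≤ n → ∀ p → (∀ {b} → 1 ≤ b → b ≤ m → Coprime b n → eval p (ζ ^ b) ≈ 0#) →
                     Σ Poly λ q → (cyclotomicUpTo n ζ m *ₚ q) ≋ p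
  cyclotomicUpTo-∣ zero    _     p _     = p , *ₚ-identityˡ p
  cyclotomicUpTo-∣ (suc m) 1+m≤n p roots with coprime? (suc m) n
  ... | no  _       = cyclotomicUpTo-∣ m (ℕₚ.<⇒≤ 1+m≤n) p λ 1≤b b≤m → roots 1≤b (ℕₚ.m≤n⇒m≤1+n b≤m)
  ... | yes coprime = map₂ (λ {q} Φq≋quotient → ≋-trans (*ₚ-right-comm (cyclotomicUpTo n ζ m) (linear a) q)
                                (≋-trans (*ₚ-congˡ (linear a) Φq≋quotient) (≋-sym (root⇒linear-factor p pa≈0))))
                            (cyclotomicUpTo-∣ m (ℕₚ.<⇒≤ 1+m≤n) (quotientByLinear a p) quotient-roots)
    where
    a : Carrier
    a = pow ζ (suc m)
    pa≈0 : eval p a ≈ 0#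
    pa≈0 = trans (reflexive (≡.cong (eval p) (pow≡^ ζ (suc m)))) (roots (s≤s z≤n) ℕₚ.≤-refl coprime)
    quotient-roots : ∀ {b} → 1 ≤ b → b ≤ m → Coprime b n → eval (quotientByLinear a p) (ζ ^ b) ≈ 0#
    quotient-roots 1≤b b≤m coprime-b = quotient-root p pa≈0 (roots 1≤b (ℕₚ.m≤n⇒m≤1+n b≤m) coprime-b) λ ζᵇ≈a →
      ζ^-distinct (s≤s b≤m) (ℕₚ.<-≤-trans (ℕₚ.∸-monoʳ-< 1≤b (ℕₚ.m≤n⇒m≤1+n b≤m)) 1+m≤n)
        (trans ζᵇ≈a (reflexive (pow≡^ ζ (suc m))))

  Φ∣R-n : cyclotomic n ζ ∣ₚ (RPoly n ζ +ₚ (-ₚ constₚ (ι n)))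
  Φ∣R-n = map₂ coeff-≈ (cyclotomicUpTo-∣ n ℕₚ.≤-refl (RPoly n ζ +ₚ (-ₚ constₚ (ι n))) roots)
    where
    roots : ∀ {b} → 1 ≤ b → b ≤ n → Coprime b n → eval (RPoly n ζ +ₚ (-ₚ constₚ (ι n))) (ζ ^ b) ≈ 0#
    roots {b} _ b≤n coprime = begin
      eval (RPoly n ζ +ₚ (-ₚ constₚ (ι n))) (ζ ^ b)           ≈⟨ eval-+ₚ (RPoly n ζ) (-ₚ constₚ (ι n)) (ζ ^ b) ⟩
      eval (RPoly n ζ) (ζ ^ b) + (- 1# * ι n + ζ ^ b * 0#)
        ≈⟨ +-cong (R[ζ^b]≈n b≤n coprime) (trans (+-cong (-1*x≈-x (ι n)) (zeroʳ _)) (+-identityʳ _)) ⟩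
      ι n + - ι n                                            ≈⟨ -‿inverseʳ (ι n) ⟩
      0#                                                     ∎

R₂[-1]≈2 : ∀ {c ℓ} (R : CommutativeRing c ℓ) → Ring.IsDomain R → ∀ ζ → Ring.IsPrimitiveRoot R 2 ζ →
           let open CommutativeRing R; open Ring R in eval (RPoly 2 ζ) (- 1#) ≈ ι 2
R₂[-1]≈2 R dom ζ prim = begin
  -- This is eval (RPoly 2 ζ) (- 1#) computed, with c₂(0) = 1 and c₂(1) = ζ.
  (0# + 1#) + - 1# * ((0# + ζ * 1#) + - 1# * 0#) ≈⟨ +-cong (+-identityˡ 1#) (*-congˡ ζ-coefficient) ⟩
  1# + - 1# * - 1#                               ≈⟨ +-congˡ -1*-1≈1 ⟩
  1# + 1#                                        ≈⟨ +-congˡ (sym (+-identityʳ 1#)) ⟩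
  1# + (1# + 0#)                                 ∎
  where
  open CommutativeRing R
  open import Algebra.Properties.Ring ring using (+-inverseʳ-unique)
  open import Relation.Binary.Reasoning.Setoid setoid
  open RingFacts R using (-1*-1≈1)
  open PrimitiveRoot R dom 1 ζ prim using (ζ^n≈1; ζ^m≉1)
  open Domain R dom using (geometric-vanishes)
  ζ≈-1 : ζ ≈ - 1#
  ζ≈-1 = trans (sym (trans (+-identityʳ _) (*-identityʳ ζ))) (+-inverseʳ-unique 1# _
    (geometric-vanishes ζ 2 ζ^n≈1 λ ζ≈1 → ζ^m≉1 (s≤s z≤n) (s≤s (s≤s z≤n)) (trans (*-identityʳ ζ) ζ≈1)))
  ζ-coefficient : (0# + ζ * 1#) + - 1# * 0# ≈ - 1#
  ζ-coefficient = trans (+-cong (trans (+-identityˡ _) (*-identityʳ ζ)) (zeroʳ _)) (trans (+-identityʳ ζ) ζ≈-1)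

theorem4 : ∀ {c ℓ} (R : CommutativeRing c ℓ) → Ring.IsDomain R →
    ∀ (n : ℕ) (ζ : CommutativeRing.Carrier R) → 1 ℕ.≤ n → Ring.IsPrimitiveRoot R n ζ →
    let open CommutativeRing R
        open Ring R
    in (n ≡ 2 → eval (RPoly n ζ) (- 1#) ≈ ι 2)
     × (Odd n → eval (RPoly n ζ) (- 1#) ≈ ι (totient n))
     × (Even n → 2 ℕ.< n → eval (RPoly n ζ) (- 1#) ≈ 0#)
     × (cyclotomic n ζ ∣ₚ (RPoly n ζ +ₚ (-ₚ constₚ (ι n))))
theorem4 R dom (suc n′) ζ (s≤s z≤n) prim =
    (λ { ≡.refl → R₂[-1]≈2 R dom ζ prim })
  , (λ { (h , n≡1+2h) → OddOrder.R[-1]≈φ h n≡1+2h })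
  , (λ { (h , n≡2h) 2<n → R[-1]≈0-even h n≡2h 2<n })
  , Φ∣R-n
  where open PrimitiveRoot R dom n′ ζ prim
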